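{- Let $C>10^6$, let $G$ be an $n$-vertex $C$-expander and let $\mathcal{F}$ be a $<_{\mathrm{lex}}$-minimal spanning linear forest in $G$. Suppose $\mathcal{F}$ contains an isolated vertex $v$, and let $\mathcal{F}'$ be a $k$-rotation of $\mathcal{F}$ with old endpoint $v$. Then $\mathcal{F}'$ is $<_{\mathrm{lex}}$-minimal, the new endpoint $u$ of $\mathcal{F}'$ is isolated in $\mathcal{F}'$, and $\mathrm{End}(\mathcal{F}')=\mathrm{End}(\mathcal{F})$.
   Context: An $n$-vertex graph $G$ ($n\ge3$) is a $C$-expander if (a) every $X\subseteq V(G)$ with $|X|<n/2C$ has at least $C|X|$ vertices outside $X$ adjacent to $X$, and (b) there is an edge between any two disjoint vertex sets each of size at least $n/2C$. A linear forest is a vertex-disjoint union of paths (single vertices allowed); $\mathrm{End}(\mathcal{F})$ is the set of endpoints of its paths (an isolated vertex counts as an endpoint). The length of a path is its number of vertices. For linear forests $\mathcal{F}_1,\mathcal{F}_2$, $\mathcal{F}_1<_{\mathrm{lex}}\mathcal{F}_2$ if $\mathcal{F}_1$ has fewer paths than $\mathcal{F}_2$, or they have the same number of paths and the vector of path lengths of $\mathcal{F}_1$ in decreasing order is lexicographically smaller than that of $\mathcal{F}_2$; $<_{\mathrm{lex}}$-minimal means minimal among all spanning linear forests of $G$. 1-rotation: let $P_1,P_2$ be (possibly equal) paths of $\mathcal{F}$, $x$ an endpoint of $P_1$, $z$ a neighbour in $G$ of $x$ on $P_2$. If $P_2$ has an edge, let $y$ be a neighbour of $z$ on $P_2$ (if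 $P_1=P_2$, the one closer to $x$, possibly $y=x$); otherwise $y=z$. Removing $yz$ (if $y\ne z$) and adding $xz$ gives a 1-rotation with old endpoint $x$, new endpoint $y$, pivot $z$. A $k$-rotation is a sequence of $k$ consecutive 1-rotations starting from $\mathcal{F}$ where each old endpoint is the previous new endpoint and each pivot is at distance at least $3$ in $\mathcal{F}$ from the first old endpoint and all earlier pivots; its old endpoint is the first old endpoint and its new endpoint the last new endpoint.
   Formalization: The constant C is taken to be a rational number greater than $10^6$. -}

module Defs where

open import Data.Nat as ℕ using (ℕ; zero; suc; _^_)
open import Data.Integer using (+_)
open import Data.Rational as ℚ using (ℚ; _/_)
open import Data.Bool using (Bool; true; false)
open import Data.Fin using (Fin)
open import Data.Fin.Subset using (Subset; _∈_; _∉_; ∣_∣; _∩_; Empty)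
open import Data.List using (List; []; _∷_; _++_; length; map; concat; reverse; allFin)
open import Data.List.Membership.Propositional using () renaming (_∈_ to _∈ₗ_)
open import Data.List.Relation.Unary.All using (All)
open import Data.List.Relation.Unary.Any using (Any)
open import Data.List.Relation.Unary.Linked using (Linked)
open import Data.List.Relation.Binary.Permutation.Propositional using (_↭_)
open import Data.List.Relation.Binary.Lex.Strict using (Lex-<)
open import Data.Product using (Σ; ∃; ∃-syntax; _×_; _,_)
open import Data.Sum using (_⊎_)
open import Relation.Nullary using (¬_)
open import Relation.Binary.PropositionalEquality using (_≡_; _≢_)
open import Function.Bundles using (_⇔_)

record Graph (n : ℕ) : Set where
  field
    adj   : Fin n → Fin n → Bool
    sym   : ∀ a b → adj a b ≡ adj b a
    irrefl : ∀ a → adj a a ≡ false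

Adj : ∀ {n} → Graph n → Fin n → Fin n → Set
Adj G a b = Graph.adj G a b ≡ true

ℕ→ℚ : ℕ → ℚ
ℕ→ℚ k = + k / 1

-- (a) every X with |X| < n/2C has at least C|X| vertices outside X
--     adjacent to X  (i.e. some set Y of such vertices with |Y| ≥ C|X|)
-- (b) any two disjoint sets of size ≥ n/2C span an edge
record IsExpander {n : ℕ} (C : ℚ) (G : Graph n) : Set where
  field
    expand : ∀ (X : Subset n) →
             ℚ._<_ (ℚ._*_ (ℚ._*_ (ℕ→ℚ 2) C) (ℕ→ℚ ∣ X ∣)) (ℕ→ℚ n) →
             ∃[ Y ] ((∀ w → w ∈ Y → w ∉ X × ∃[ x ] (x ∈ X × Adj G x w))
                    × ℚ._≤_ (ℚ._*_ C (ℕ→ℚ ∣ X ∣)) (ℕ→ℚ ∣ Y ∣))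
    joined : ∀ (A B : Subset n) → Empty (A ∩ B) →
             ℚ._≤_ (ℕ→ℚ n) (ℚ._*_ (ℚ._*_ (ℕ→ℚ 2) C) (ℕ→ℚ ∣ A ∣)) →
             ℚ._≤_ (ℕ→ℚ n) (ℚ._*_ (ℚ._*_ (ℕ→ℚ 2) C) (ℕ→ℚ ∣ B ∣)) →
             ∃[ a ] ∃[ b ] (a ∈ A × b ∈ B × Adj G a b)

-- Linear forests, represented as lists of paths; a path is a list of
-- vertices (its length is its number of vertices).

Path : ℕ → Set
Path n = List (Fin n)

Forest : ℕ → Set
Forest n = List (Path n)

record IsSpanningLF {n : ℕ} (G : Graph n) (F : Forest n) : Set where
  field
    nonempty : All (λ P → P ≢ []) F
    along    : All (Linked (Adj G)) F
    spanning : concat F ↭ allFin n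

Consec : ∀ {n} → Path n → Fin n → Fin n → Set
Consec P a b = ∃[ xs ] ∃[ ys ] (P ≡ xs ++ a ∷ b ∷ ys)

EdgeF : ∀ {n} → Forest n → Fin n → Fin n → Set
EdgeF F a b = Any (λ P → Consec P a b ⊎ Consec P b a) F

-- x is an endpoint of the path P (a single vertex is an endpoint)
IsEndOf : ∀ {n} → Path n → Fin n → Set
IsEndOf P x = ∃[ ys ] (P ≡ x ∷ ys ⊎ P ≡ ys ++ x ∷ [])

IsEnd : ∀ {n} → Forest n → Fin n → Set
IsEnd F x = Any (λ P → IsEndOf P x) F

Isolated : ∀ {n} → Forest n → Fin n → Set
Isolated F x = (x ∷ []) ∈ₗ F

DecLengths : ∀ {n} → Forest n → List ℕ → Set
DecLengths F L = (L ↭ map length F) × Linked ℕ._≥_ L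

_<lex_ : ∀ {n} → Forest n → Forest n → Set
F₁ <lex F₂ = ℕ._<_ (length F₁) (length F₂)
           ⊎ (length F₁ ≡ length F₂ ×
              ∃[ L₁ ] ∃[ L₂ ] (DecLengths F₁ L₁ × DecLengths F₂ L₂ ×
                               Lex-< _≡_ ℕ._<_ L₁ L₂))

LexMinimal : ∀ {n} → Graph n → Forest n → Set
LexMinimal G F = IsSpanningLF G F × (∀ F₂ → IsSpanningLF G F₂ → ¬ (F₂ <lex F))

SamePair : ∀ {n} → Fin n → Fin n → Fin n → Fin n → Set
SamePair a b c d = (a ≡ c × b ≡ d) ⊎ (a ≡ d × b ≡ c)

-- y is an admissible new endpoint for old endpoint x and pivot z lying
-- on the path P₂ (which contains x iff P₁ = P₂):
--  * if P₂ is the single vertex z, then y = z;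
--  * if P₂ has an edge and x ∉ P₂ (P₁ ≠ P₂), y is a neighbour of z on P₂;
--  * if P₂ has an edge and x ∈ P₂ (P₁ = P₂), y is the neighbour of z
--    on P₂ closer to x (possibly y = x).
NewEnd : ∀ {n} → Path n → Fin n → Fin n → Fin n → Set
NewEnd P₂ x z y =
    (P₂ ≡ z ∷ [] × y ≡ z)
  ⊎ (¬ (x ∈ₗ P₂) × (Consec P₂ y z ⊎ Consec P₂ z y))
  ⊎ (x ∈ₗ P₂ × ∃[ Q ] ((Q ≡ P₂ ⊎ Q ≡ reverse P₂) ×
        ∃[ ws ] ∃[ ys ] (Q ≡ x ∷ ws ++ y ∷ z ∷ ys
                         ⊎ (y ≡ x × Q ≡ x ∷ z ∷ ys))))

-- F' is obtained from F by a 1-rotation with old endpoint x,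
-- new endpoint y and pivot z (F' is described up to the order and
-- orientation of its paths, i.e. via its edge set)
record OneRot {n : ℕ} (G : Graph n) (F : Forest n) (x y z : Fin n)
              (F' : Forest n) : Set where
  field
    P₁ P₂   : Path n
    P₁∈F    : P₁ ∈ₗ F
    P₂∈F    : P₂ ∈ₗ F
    x-end   : IsEndOf P₁ x
    z∈P₂    : z ∈ₗ P₂
    xz∈G    : Adj G x z
    y-new   : NewEnd P₂ x z y
    F'-lf   : IsSpanningLF G F'
    F'-edges : ∀ a b → EdgeF F' a b ⇔
                 ((EdgeF F a b × ¬ SamePair a b y z) ⊎ SamePair a b x z)

Far3 : ∀ {n} → Forest n → Fin n → Fin n → Set
Far3 F a b = a ≢ b × ¬ EdgeF F a b × ¬ (∃[ c ] (EdgeF F a c × EdgeF F c b))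

-- KRot G F x₀ k zs F' y : F' is obtained from F by a k-rotation with
-- old endpoint x₀, new endpoint y and pivots zs (latest first)
data KRot {n : ℕ} (G : Graph n) (F : Forest n) (x₀ : Fin n) :
          ℕ → List (Fin n) → Forest n → Fin n → Set where
  done : KRot G F x₀ 0 [] F x₀
  step : ∀ {k zs F₁ F₂ x y z} →
         KRot G F x₀ k zs F₁ x →
         OneRot G F₁ x y z F₂ →
         Far3 F z x₀ →
         All (Far3 F z) zs →
         KRot G F x₀ (suc k) (z ∷ zs) F₂ y

-- Consider one rotation step from an isolated
-- vertex x with pivot z on another path Q. Q is not the single vertex z, for joining x and
-- z would leave fewer paths. So the new endpoint y is the neighbour of z on Q; orient Q so
-- that y precedes z. If y were not the first vertex of Q, removing yz and adding xz would
-- split Q into two paths both shorter than Q, lowering the sorted vector of path lengths.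
-- Hence Q = y z ..., and the rotation merely exchanges x and y: the path lengths are
-- unchanged, y becomes isolated and the set of endpoints is the same. A rotated forest is
-- only specified through its edge set, so we also show that path lengths, endpoints and
-- isolated vertices of a spanning linear forest are determined by its edges: the paths are
-- the connected components, and the endpoints are the vertices without two distinct
-- neighbours.

module Submission where

open import Defs
open import Data.Nat using (ℕ; _≤_; _^_)
open import Data.Rational using (ℚ; _<_)
open import Data.List using (List)
open import Data.Fin using (Fin)
open import Data.Product using (_×_)
open import Function.Bundles using (_⇔_)

import Data.Nat as ℕ
import Data.Nat.Properties as ℕ
open import Relation.Binary.Properties.DecTotalOrder ℕ.≤-decTotalOrder using (≥-decTotalOrder)
open import Data.List.Sort ≥-decTotalOrder using (sort; sort-↭; sort-↗)
open import Data.List using ([]; _∷_; _++_; [_]; _∷ʳ_; length; map; concat; reverse; initLast; _∷ʳ′_)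
open import Data.List.Properties using (++-assoc; ++-conicalʳ; ∷-injective; reverse-++; reverse-involutive; reverse-injective; length-++; length-map)
open import Data.List.Membership.Propositional using (_∈_; _∉_; find; lose)
open import Data.List.Membership.Propositional.Properties using (∈-++⁺ˡ; ∈-++⁺ʳ; ∈-++⁻; ∈-∃++; ∈-concat⁺′; ∈-concat⁻′; ∈-allFin)
open import Data.List.Membership.Propositional.Properties.WithK using (unique∧set⇒bag)
open import Data.List.Relation.Binary.BagAndSetEquality using (∼bag⇒↭; ↭⇒∼bag; concat-cong)
open import Data.List.Relation.Binary.Subset.Propositional using (_⊆_)
open import Data.List.Relation.Binary.Lex.Strict using (Lex-<; this; next)
open import Data.List.Relation.Binary.Permutation.Propositional using (_↭_; ↭-refl; ↭-sym; ↭-trans; ↭-reflexive; prep; swap; ↭⇒↭ₛ; module PermutationReasoning)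
import Data.List.Relation.Binary.Permutation.Propositional.Properties as ↭
import Data.List.Relation.Binary.Permutation.Setoid.Properties as ↭ₛ
open import Data.List.Relation.Unary.All as All using ([]; _∷_)
import Data.List.Relation.Unary.All.Properties as All
open import Data.List.Relation.Unary.Any as Any using (here; there)
open import Data.List.Relation.Unary.Linked as Linked using (Linked; []; [-]; _∷_)
open import Data.List.Relation.Unary.Linked.Properties using (Linked⇒All)
open import Data.List.Relation.Unary.Unique.Propositional using (Unique)
open import Data.List.Relation.Unary.Unique.Propositional.Properties using (allFin⁺; Unique[x∷xs]⇒x∉xs)
open import Data.List.Relation.Unary.AllPairs using ([]; _∷_)
open import Relation.Binary.Construct.Closure.ReflexiveTransitive as Star using (Star; ε; _◅_; _◅◅_)
open import Data.Product using (∃-syntax; _,_; proj₁; proj₂)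
open import Data.Sum using (_⊎_; inj₁; inj₂)
open import Data.Empty using (⊥-elim)
open import Relation.Nullary using (¬_; yes; no)
open import Relation.Binary.PropositionalEquality using (_≡_; _≢_; refl; sym; trans; cong; subst; subst₂; setoid; module ≡-Reasoning)
open import Function.Bundles using (mk⇔; Equivalence)
open import Function.Base using (_∘_)
import Function.Properties.Equivalence as ⇔

private variable
  A : Set
  xs ys P Q : List A

Unique-resp-↭ : Unique xs → xs ↭ ys → Unique ys
Unique-resp-↭ u p = ↭ₛ.Unique-resp-↭ (setoid _) (↭⇒↭ₛ p) u

Unique-++⁻ˡ : ∀ xs → Unique (xs ++ ys) → Unique xs
Unique-++⁻ˡ []       _          = []
Unique-++⁻ˡ (_ ∷ xs) (x∉ ∷ u) = All.++⁻ˡ xs x∉ ∷ Unique-++⁻ˡ xs u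

Unique-++⁻ʳ : ∀ xs → Unique (xs ++ ys) → Unique ys
Unique-++⁻ʳ []       u       = u
Unique-++⁻ʳ (_ ∷ xs) (_ ∷ u) = Unique-++⁻ʳ xs u

Unique-++-disjoint : ∀ xs {a} → Unique (xs ++ ys) → a ∈ xs → a ∉ ys
Unique-++-disjoint (_ ∷ xs) (x∉ ∷ _) (here refl) a∈ys = All.lookup x∉ (∈-++⁺ʳ xs a∈ys) refl
Unique-++-disjoint (_ ∷ xs) (_ ∷ u)  (there a∈xs)     = Unique-++-disjoint xs u a∈xs

unique∧⊇⊆⇒↭ : Unique xs → Unique ys → xs ⊆ ys → ys ⊆ xs → xs ↭ ys
unique∧⊇⊆⇒↭ u v xs⊆ys ys⊆xs = ∼bag⇒↭ (unique∧set⇒bag u v (mk⇔ xs⊆ys ys⊆xs))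

Unique∧constant⇒≡[-] : ∀ {w} → Unique P → w ∈ P → (∀ {b} → b ∈ P → b ≡ w) → P ≡ [ w ]
Unique∧constant⇒≡[-] {P = _ ∷ []}    _                _ all-w = cong [_] (all-w (here refl))
Unique∧constant⇒≡[-] {P = _ ∷ _ ∷ _} ((p≢q ∷ _) ∷ _) _ all-w =
  ⊥-elim (p≢q (trans (all-w (here refl)) (sym (all-w (there (here refl))))))

++-cancel-⊆ : ∀ P → Unique (P ++ xs) → Q ⊆ P → P ++ xs ⊆ Q ++ ys → xs ⊆ ys
++-cancel-⊆ {Q = Q} P u Q⊆P ⊆ a∈xs with ∈-++⁻ Q (⊆ (∈-++⁺ʳ P a∈xs))
... | inj₁ a∈Q  = ⊥-elim (Unique-++-disjoint P u (Q⊆P a∈Q) a∈xs)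
... | inj₂ a∈ys = a∈ys

∈⇒↭-∷ : ∀ {a} → a ∈ xs → ∃[ ys ] xs ↭ a ∷ ys
∈⇒↭-∷ a∈xs with ∈-∃++ a∈xs
... | ys₁ , ys₂ , refl = ys₁ ++ ys₂ , ↭.shift _ ys₁ ys₂

∈-∈⇒↭-∷-∷ : ∀ {a b} → a ∈ xs → b ∈ xs → a ≢ b → ∃[ zs ] xs ↭ a ∷ b ∷ zs
∈-∈⇒↭-∷-∷ a∈xs b∈xs a≢b with ∈⇒↭-∷ a∈xs
... | ys , xs↭ with ↭.∈-resp-↭ xs↭ b∈xs
...   | here b≡a    = ⊥-elim (a≢b (sym b≡a))
...   | there b∈ys with ∈⇒↭-∷ b∈ys
...     | zs , ys↭ = zs , ↭-trans xs↭ (prep _ ys↭)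

concat-↭ : {F H : List (List A)} → F ↭ H → concat F ↭ concat H
concat-↭ F↭H = ∼bag⇒↭ (concat-cong (↭⇒∼bag F↭H))

path-Unique : (F : List (List A)) → Unique (concat F) → P ∈ F → Unique P
path-Unique (P ∷ F) u (here refl)  = Unique-++⁻ˡ P u
path-Unique (P ∷ F) u (there P∈F) = path-Unique F (Unique-++⁻ʳ P u) P∈F

paths-meet⇒≡ : (F : List (List A)) {a : A} → Unique (concat F) → P ∈ F → Q ∈ F → a ∈ P → a ∈ Q → P ≡ Q
paths-meet⇒≡ (R ∷ F) u (here refl)  (here refl)  _   _   = refl
paths-meet⇒≡ (R ∷ F) u (here refl)  (there Q∈F) a∈P a∈Q =
  ⊥-elim (Unique-++-disjoint R u a∈P (∈-concat⁺′ a∈Q Q∈F))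
paths-meet⇒≡ (R ∷ F) u (there P∈F) (here refl)  a∈P a∈Q =
  ⊥-elim (Unique-++-disjoint R u a∈Q (∈-concat⁺′ a∈P P∈F))
paths-meet⇒≡ (R ∷ F) u (there P∈F) (there Q∈F) a∈P a∈Q =
  paths-meet⇒≡ F (Unique-++⁻ʳ R u) P∈F Q∈F a∈P a∈Q

BlocksRefine : List (List A) → List (List A) → Set
BlocksRefine F H = ∀ {P Q a} → P ∈ F → Q ∈ H → a ∈ P → a ∈ Q → P ⊆ Q

sameBlocks⇒lengths-↭ : (F H : List (List A)) → Unique (concat F) → Unique (concat H) →
                        (∀ {P} → P ∈ F → P ≢ []) → (∀ {Q} → Q ∈ H → Q ≢ []) →
                        concat F ⊆ concat H → concat H ⊆ concat F →
                        BlocksRefine F H → BlocksRefine H F → map length F ↭ map length H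
sameBlocks⇒lengths-↭ [] [] _ _ _ _ _ _ _ _ = ↭-refl
sameBlocks⇒lengths-↭ [] ([] ∷ H) _ _ _ neH _ _ _ _ = ⊥-elim (neH (here refl) refl)
sameBlocks⇒lengths-↭ [] ((_ ∷ _) ∷ H) _ _ _ _ _ H⊆F _ _ with H⊆F (here refl)
... | ()
sameBlocks⇒lengths-↭ ([] ∷ F) H _ _ neF _ _ _ _ _ = ⊥-elim (neF (here refl) refl)
sameBlocks⇒lengths-↭ (P@(p ∷ _) ∷ F) H uPF uH neF neH PF⊆H H⊆PF F≤H H≤F
  with ∈-concat⁻′ H (PF⊆H (here refl))
... | Q , p∈Q , Q∈H with ∈⇒↭-∷ Q∈H
... | H₀ , H↭ = begin
  length P ∷ map length F   ≡⟨ cong (_∷ map length F) |P|≡|Q| ⟩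
  length Q ∷ map length F   ↭⟨ prep (length Q) lengths-rest ⟩
  length Q ∷ map length H₀  ↭⟨ ↭-sym (↭.map⁺ length H↭) ⟩
  map length H              ∎
  where
  open PermutationReasoning
  P⊆Q : P ⊆ Q
  P⊆Q = F≤H (here refl) Q∈H (here refl) p∈Q
  Q⊆P : Q ⊆ P
  Q⊆P = H≤F Q∈H (here refl) p∈Q (here refl)
  concatH↭ : concat H ↭ Q ++ concat H₀
  concatH↭ = concat-↭ H↭
  uQH₀ : Unique (Q ++ concat H₀)
  uQH₀ = Unique-resp-↭ uH concatH↭
  |P|≡|Q| : length P ≡ length Q
  |P|≡|Q| = ↭.↭-length (unique∧⊇⊆⇒↭ (Unique-++⁻ˡ P uPF) (Unique-++⁻ˡ Q uQH₀) P⊆Q Q⊆P)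
  H₀⊆H : ∀ {R} → R ∈ H₀ → R ∈ H
  H₀⊆H R∈H₀ = ↭.∈-resp-↭ (↭-sym H↭) (there R∈H₀)
  lengths-rest : map length F ↭ map length H₀
  lengths-rest = sameBlocks⇒lengths-↭ F H₀ (Unique-++⁻ʳ P uPF) (Unique-++⁻ʳ Q uQH₀)
    (neF ∘ there) (neH ∘ H₀⊆H)
    (++-cancel-⊆ P uPF Q⊆P (↭.∈-resp-↭ concatH↭ ∘ PF⊆H))
    (++-cancel-⊆ Q uQH₀ P⊆Q (H⊆PF ∘ ↭.∈-resp-↭ (↭-sym concatH↭)))
    (λ P∈F → F≤H (there P∈F) ∘ H₀⊆H) (λ R∈H₀ P∈F → H≤F (H₀⊆H R∈H₀) (there P∈F))

≤-head : ∀ {h x T} → Linked ℕ._≥_ (h ∷ T) → x ∈ h ∷ T → x ℕ.≤ h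
≤-head l = All.lookup (Linked⇒All (λ b≤a c≤b → ℕ.≤-trans c≤b b≤a) ℕ.≤-refl l)

descending-Lex-< : ∀ {L₁ L₂ a c b d M} → Linked ℕ._≥_ L₁ → Linked ℕ._≥_ L₂ →
                   L₁ ↭ a ∷ c ∷ M → L₂ ↭ b ∷ d ∷ M → a ℕ.< b → c ℕ.< b → Lex-< _≡_ ℕ._<_ L₁ L₂
descending-Lex-< {[]} _ _ L₁↭ _ _ _ with ↭.↭-length L₁↭
... | ()
descending-Lex-< {_ ∷ _} {[]} _ _ _ L₂↭ _ _ with ↭.↭-length L₂↭
... | ()
descending-Lex-< {h₁ ∷ T₁} {h₂ ∷ T₂} l₁ l₂ L₁↭ L₂↭ a<b c<b with h₁ ℕ.<? h₂
... | yes h₁<h₂ = this h₁<h₂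
... | no h₁≮h₂
  with b≤h₁ ← ℕ.≤-trans (≤-head l₂ (↭.∈-resp-↭ (↭-sym L₂↭) (here refl))) (ℕ.≮⇒≥ h₁≮h₂)
  with ↭.∈-resp-↭ L₁↭ (here refl)
...   | here refl         = ⊥-elim (ℕ.<⇒≱ a<b b≤h₁)
...   | there (here refl) = ⊥-elim (ℕ.<⇒≱ c<b b≤h₁)
...   | there (there h₁∈M)
  with M′ , M↭ ← ∈⇒↭-∷ h₁∈M
  with refl ← ℕ.≤-antisym (ℕ.≮⇒≥ h₁≮h₂) (≤-head l₂ (↭.∈-resp-↭ (↭-sym L₂↭) (there (there h₁∈M)))) =
  next refl (descending-Lex-< (Linked.tail l₁) (Linked.tail l₂)
    (↭.drop-∷ (↭-trans L₁↭ (to-front M↭))) (↭.drop-∷ (↭-trans L₂↭ (to-front M↭))) a<b c<b)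
  where
  to-front : ∀ {u v M} → M ↭ h₁ ∷ M′ → u ∷ v ∷ M ↭ h₁ ∷ u ∷ v ∷ M′
  to-front {u} {v} M↭ = ↭-trans (prep u (prep v M↭)) (↭-trans (prep u (swap v h₁ ↭-refl)) (swap u h₁ ↭-refl))

Linked⇒Star : ∀ {ℓ} {_~_ : A → A → Set ℓ} {r x} → Linked _~_ (r ∷ P) → x ∈ r ∷ P → Star _~_ r x
Linked⇒Star _        (here refl) = ε
Linked⇒Star (e ∷ es) (there x∈)  = e ◅ Linked⇒Star es x∈

module _ {n : ℕ} where

  PathEdge : Path n → Fin n → Fin n → Set
  PathEdge P a b = Consec P a b ⊎ Consec P b a

  SameEdges : Forest n → Forest n → Set
  SameEdges F H = ∀ a b → EdgeF F a b ⇔ EdgeF H a b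

  SameEnds : Forest n → Forest n → Set
  SameEnds F H = ∀ w → IsEnd F w ⇔ IsEnd H w

  private variable
    a b c d w x y z : Fin n
    R S : Path n
    F H : Forest n

  Consec-∈ : Consec R a b → a ∈ R × b ∈ R
  Consec-∈ (xs , _ , refl) = ∈-++⁺ʳ xs (here refl) , ∈-++⁺ʳ xs (there (here refl))

  Consec-∷⁺ : Consec R a b → Consec (c ∷ R) a b
  Consec-∷⁺ (xs , ys , refl) = _ ∷ xs , ys , refl

  Consec-∷⁻ : Consec (c ∷ R) a b → (a ≡ c × ∃[ S ] R ≡ b ∷ S) ⊎ Consec R a b
  Consec-∷⁻ ([]     , ys , refl) = inj₁ (refl , ys , refl)
  Consec-∷⁻ (_ ∷ xs , ys , eq)   = inj₂ (xs , ys , proj₂ (∷-injective eq))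

  Consec-[-] : ¬ Consec [ c ] a b
  Consec-[-] ([]         , _ , ())
  Consec-[-] (_ ∷ []     , _ , ())
  Consec-[-] (_ ∷ _ ∷ _ , _ , ())

  Consec-++⁺ˡ : ∀ S → Consec R a b → Consec (S ++ R) a b
  Consec-++⁺ˡ S (xs , ys , refl) = S ++ xs , ys , sym (++-assoc S xs _)

  Consec-++⁺ʳ : ∀ S → Consec R a b → Consec (R ++ S) a b
  Consec-++⁺ʳ S (xs , ys , refl) = xs , ys ++ S , ++-assoc xs _ S

  Consec-reverse : Consec R a b → Consec (reverse R) b a
  Consec-reverse {a = a} {b = b} (xs , ys , refl) = reverse ys , reverse xs , (begin
    reverse (xs ++ a ∷ b ∷ ys)            ≡⟨ reverse-++ xs (a ∷ b ∷ ys) ⟩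
    reverse (a ∷ b ∷ ys) ++ reverse xs    ≡⟨ cong (_++ reverse xs) (reverse-++ (a ∷ b ∷ []) ys) ⟩
    (reverse ys ++ b ∷ a ∷ []) ++ reverse xs ≡⟨ ++-assoc (reverse ys) (b ∷ a ∷ []) (reverse xs) ⟩
    reverse ys ++ b ∷ a ∷ reverse xs      ∎)
    where open ≡-Reasoning

  Consec-reverse⁻ : Consec (reverse R) a b → Consec R b a
  Consec-reverse⁻ {R = R} c = subst (λ S → Consec S _ _) (reverse-involutive R) (Consec-reverse c)

  Linked⇒Consec : ∀ {ℓ} {_~_ : Fin n → Fin n → Set ℓ} → Linked _~_ R → Consec R a b → a ~ b
  Linked⇒Consec []       ([]    , _ , ())
  Linked⇒Consec []       (_ ∷ _ , _ , ())
  Linked⇒Consec [-]      c = ⊥-elim (Consec-[-] c)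
  Linked⇒Consec (r ∷ rs) c with Consec-∷⁻ c
  ... | inj₁ (refl , _ , refl) = r
  ... | inj₂ c′               = Linked⇒Consec rs c′

  Consec⇒Linked : ∀ {ℓ} {_~_ : Fin n → Fin n → Set ℓ} R → (∀ {a b} → Consec R a b → a ~ b) → Linked _~_ R
  Consec⇒Linked []            _ = []
  Consec⇒Linked (_ ∷ [])      _ = [-]
  Consec⇒Linked (_ ∷ _ ∷ R) f = f ([] , R , refl) ∷ Consec⇒Linked (_ ∷ R) (f ∘ Consec-∷⁺)

  PathEdge-∈ : PathEdge R a b → a ∈ R × b ∈ R
  PathEdge-∈ (inj₁ c) = Consec-∈ c
  PathEdge-∈ (inj₂ c) = let b∈ , a∈ = Consec-∈ c in a∈ , b∈

  PathEdge-sym : PathEdge R a b → PathEdge R b a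
  PathEdge-sym (inj₁ c) = inj₂ c
  PathEdge-sym (inj₂ c) = inj₁ c

  PathEdge-[-] : ¬ PathEdge [ c ] a b
  PathEdge-[-] (inj₁ c) = Consec-[-] c
  PathEdge-[-] (inj₂ c) = Consec-[-] c

  PathEdge-∷⁺ : PathEdge R a b → PathEdge (c ∷ R) a b
  PathEdge-∷⁺ (inj₁ k) = inj₁ (Consec-∷⁺ k)
  PathEdge-∷⁺ (inj₂ k) = inj₂ (Consec-∷⁺ k)

  PathEdge-∷⁻ : PathEdge (c ∷ d ∷ R) a b → SamePair a b c d ⊎ PathEdge (d ∷ R) a b
  PathEdge-∷⁻ (inj₁ k) with Consec-∷⁻ k
  ... | inj₁ (refl , _ , refl) = inj₁ (inj₁ (refl , refl))
  ... | inj₂ k′               = inj₂ (inj₁ k′)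
  PathEdge-∷⁻ (inj₂ k) with Consec-∷⁻ k
  ... | inj₁ (refl , _ , refl) = inj₁ (inj₂ (refl , refl))
  ... | inj₂ k′               = inj₂ (inj₂ k′)

  SamePair⇒PathEdge : SamePair a b c d → PathEdge (c ∷ d ∷ R) a b
  SamePair⇒PathEdge (inj₁ (refl , refl)) = inj₁ ([] , _ , refl)
  SamePair⇒PathEdge (inj₂ (refl , refl)) = inj₂ ([] , _ , refl)

  SamePair-∈ : SamePair a b c d → a ∈ R → b ∈ R → c ∈ R
  SamePair-∈ (inj₁ (refl , _)) a∈ _  = a∈
  SamePair-∈ (inj₂ (_ , refl)) _  b∈ = b∈

  PathEdge-reverse : PathEdge R a b ⇔ PathEdge (reverse R) a b
  PathEdge-reverse = mk⇔
    (λ { (inj₁ c) → inj₂ (Consec-reverse c) ; (inj₂ c) → inj₁ (Consec-reverse c) })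
    (λ { (inj₁ c) → inj₂ (Consec-reverse⁻ c) ; (inj₂ c) → inj₁ (Consec-reverse⁻ c) })

  EdgeF-sym : EdgeF F a b → EdgeF F b a
  EdgeF-sym = Any.map PathEdge-sym

  -- Components and endpoints of a linear forest

  module _ {G : Graph n} (s : IsSpanningLF G F) where

    spanning-Unique : Unique (concat F)
    spanning-Unique = Unique-resp-↭ (allFin⁺ n) (↭-sym (IsSpanningLF.spanning s))

    spanning-∈ : ∀ a → a ∈ concat F
    spanning-∈ a = ↭.∈-resp-↭ (↭-sym (IsSpanningLF.spanning s)) (∈-allFin a)

    spanning-nonempty : R ∈ F → R ≢ []
    spanning-nonempty = All.lookup (IsSpanningLF.nonempty s)

  Reach : Forest n → Fin n → Fin n → Set
  Reach F = Star (EdgeF F)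

  Reach-within : Unique (concat F) → R ∈ F → a ∈ R → Reach F a b → b ∈ R
  Reach-within u R∈F a∈R ε = a∈R
  Reach-within {F = F} u R∈F a∈R (e ◅ r) with find e
  ... | S , S∈F , eS with refl ← paths-meet⇒≡ F u S∈F R∈F (proj₁ (PathEdge-∈ eS)) a∈R =
    Reach-within u R∈F (proj₂ (PathEdge-∈ eS)) r

  within-Reach : R ∈ F → a ∈ R → b ∈ R → Reach F a b
  within-Reach {R = r ∷ R} {F = F} R∈F a∈R b∈R =
    Star.reverse EdgeF-sym (Linked⇒Star linked a∈R) ◅◅ Linked⇒Star linked b∈R
    where
    linked : Linked (EdgeF F) (r ∷ R)
    linked = Consec⇒Linked (r ∷ R) (lose R∈F ∘ inj₁)

  TwoNeighbours : Forest n → Fin n → Set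
  TwoNeighbours F w = ∃[ a ] ∃[ b ] a ≢ b × EdgeF F w a × EdgeF F w b

  IsEndOf-∈ : IsEndOf R w → w ∈ R
  IsEndOf-∈ (_  , inj₁ refl) = here refl
  IsEndOf-∈ (ys , inj₂ refl) = ∈-++⁺ʳ ys (here refl)

  head-neighbour : Unique (w ∷ R) → PathEdge (w ∷ R) w a → ∃[ S ] R ≡ a ∷ S
  head-neighbour u (inj₁ c) with Consec-∷⁻ c
  ... | inj₁ (_ , S , R≡) = S , R≡
  ... | inj₂ c′          = ⊥-elim (Unique[x∷xs]⇒x∉xs u (proj₁ (Consec-∈ c′)))
  head-neighbour u (inj₂ c) with Consec-∷⁻ c
  ... | inj₁ (refl , S , refl) = ⊥-elim (Unique[x∷xs]⇒x∉xs u (here refl))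
  ... | inj₂ c′               = ⊥-elim (Unique[x∷xs]⇒x∉xs u (proj₂ (Consec-∈ c′)))

  end-neighbour-unique : Unique R → IsEndOf R w → PathEdge R w a → PathEdge R w b → a ≡ b
  end-neighbour-unique u (_ , inj₁ refl) ea eb
    with S , refl ← head-neighbour u ea | _ , eq ← head-neighbour u eb = proj₁ (∷-injective eq)
  end-neighbour-unique {R = R} {w = w} u (ys , inj₂ refl) ea eb =
    end-neighbour-unique (subst Unique rev≡ (Unique-resp-↭ u (↭-sym (↭.↭-reverse R))))
      (_ , inj₁ refl) (reversed ea) (reversed eb)
    where
    rev≡ : reverse R ≡ w ∷ reverse ys
    rev≡ = reverse-++ ys [ w ]
    reversed : ∀ {x} → PathEdge R w x → PathEdge (w ∷ reverse ys) w x
    reversed e = subst (λ S → PathEdge S _ _) rev≡ (Equivalence.to PathEdge-reverse e)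

  IsEnd⇒¬TwoNeighbours : Unique (concat F) → IsEnd F w → ¬ TwoNeighbours F w
  IsEnd⇒¬TwoNeighbours {F = F} u end (a , b , a≢b , ea , eb)
    with R , R∈F , endR ← find end | Ra , Ra∈F , eRa ← find ea | Rb , Rb∈F , eRb ← find eb
    with refl ← paths-meet⇒≡ F u Ra∈F R∈F (proj₁ (PathEdge-∈ eRa)) (IsEndOf-∈ endR)
    with refl ← paths-meet⇒≡ F u Rb∈F R∈F (proj₁ (PathEdge-∈ eRb)) (IsEndOf-∈ endR) =
    a≢b (end-neighbour-unique (path-Unique F u R∈F) endR eRa eRb)

  ¬TwoNeighbours⇒IsEnd : Unique (concat F) → w ∈ concat F → ¬ TwoNeighbours F w → IsEnd F w
  ¬TwoNeighbours⇒IsEnd {F = F} {w = w} u w∈F ¬two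
    with R , w∈R , R∈F ← ∈-concat⁻′ F w∈F
    with ∈-∃++ w∈R
  ... | xs , []     , eq = lose R∈F (xs , inj₂ eq)
  ... | xs , t ∷ ts , eq with initLast xs
  ...   | []      = lose R∈F (t ∷ ts , inj₁ eq)
  ...   | i ∷ʳ′ l =
    ⊥-elim (¬two (l , t , l≢t , lose R∈F (inj₂ (i , t ∷ ts , eq′)) , lose R∈F (inj₁ (i ∷ʳ l , ts , eq))))
    where
    eq′ : R ≡ i ++ l ∷ w ∷ t ∷ ts
    eq′ = trans eq (++-assoc i [ l ] (w ∷ t ∷ ts))
    l≢t : l ≢ t
    l≢t refl = Unique[x∷xs]⇒x∉xs (Unique-++⁻ʳ i (subst Unique eq′ (path-Unique F u R∈F))) (there (here refl))

  Isolated⇒¬EdgeF : Unique (concat F) → Isolated F w → ¬ EdgeF F w a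
  Isolated⇒¬EdgeF {F = F} u iso e with R , R∈F , eR ← find e
    with refl ← paths-meet⇒≡ F u R∈F iso (proj₁ (PathEdge-∈ eR)) (here refl) = PathEdge-[-] eR

  ¬EdgeF⇒Isolated : {G : Graph n} → IsSpanningLF G F → (∀ a → ¬ EdgeF F w a) → Isolated F w
  ¬EdgeF⇒Isolated {F = F} {w = w} s no-edge with R , w∈R , R∈F ← ∈-concat⁻′ F (spanning-∈ s w) =
    subst (_∈ F) (Unique∧constant⇒≡[-] (path-Unique F (spanning-Unique s) R∈F) w∈R
                    (λ b∈R → stuck (within-Reach R∈F w∈R b∈R)))
                 R∈F
    where
    stuck : Reach F w b → b ≡ w
    stuck ε       = refl
    stuck (e ◅ _) = ⊥-elim (no-edge _ e)

  -- What the edge set of a spanning linear forest determines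

  module _ {G : Graph n} (sF : IsSpanningLF G F) (sH : IsSpanningLF G H) (same : SameEdges F H) where

    sameEdges⇒lengths-↭ : map length F ↭ map length H
    sameEdges⇒lengths-↭ = sameBlocks⇒lengths-↭ F H (spanning-Unique sF) (spanning-Unique sH)
      (spanning-nonempty sF) (spanning-nonempty sH)
      (λ {a} _ → spanning-∈ sH a) (λ {a} _ → spanning-∈ sF a)
      (λ R∈F S∈H a∈R a∈S b∈R →
         Reach-within (spanning-Unique sH) S∈H a∈S (Star.map (Equivalence.to (same _ _)) (within-Reach R∈F a∈R b∈R)))
      (λ S∈H R∈F a∈S a∈R b∈S →
         Reach-within (spanning-Unique sF) R∈F a∈R (Star.map (Equivalence.from (same _ _)) (within-Reach S∈H a∈S b∈S)))

    sameEdges⇒SameEnds : SameEnds F H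
    sameEdges⇒SameEnds w = mk⇔
      (λ end → ¬TwoNeighbours⇒IsEnd (spanning-Unique sH) (spanning-∈ sH w)
                 (IsEnd⇒¬TwoNeighbours (spanning-Unique sF) end ∘ two (Equivalence.from ∘ same w)))
      (λ end → ¬TwoNeighbours⇒IsEnd (spanning-Unique sF) (spanning-∈ sF w)
                 (IsEnd⇒¬TwoNeighbours (spanning-Unique sH) end ∘ two (Equivalence.to ∘ same w)))
      where
      two : ∀ {F₁ F₂} → (∀ a → EdgeF F₁ w a → EdgeF F₂ w a) → TwoNeighbours F₁ w → TwoNeighbours F₂ w
      two f (a , b , a≢b , ea , eb) = a , b , a≢b , f a ea , f b eb

    sameEdges⇒Isolated : Isolated F w → Isolated H w
    sameEdges⇒Isolated {w = w} iso =
      ¬EdgeF⇒Isolated sH (λ a e → Isolated⇒¬EdgeF (spanning-Unique sF) iso (Equivalence.from (same w a) e))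

  lengths-↭⇒length-≡ : map length F ↭ map length H → length F ≡ length H
  lengths-↭⇒length-≡ {F = F} {H = H} p =
    trans (sym (length-map length F)) (trans (↭.↭-length p) (length-map length H))

  <lex-resp-lengths : ∀ {F₀} → map length F ↭ map length H → F₀ <lex F → F₀ <lex H
  <lex-resp-lengths p (inj₁ fewer) = inj₁ (subst (ℕ._<_ _) (lengths-↭⇒length-≡ p) fewer)
  <lex-resp-lengths p (inj₂ (eq , L₀ , L , dec₀ , (L↭ , L↘) , lex)) =
    inj₂ (trans eq (lengths-↭⇒length-≡ p) , L₀ , L , dec₀ , (↭-trans L↭ p , L↘) , lex)

  LexMinimal-sameEdges : {G : Graph n} → LexMinimal G F → IsSpanningLF G H → SameEdges F H → LexMinimal G H
  LexMinimal-sameEdges (sF , minimal) sH same =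
    sH , λ F₀ s₀ → minimal F₀ s₀ ∘ <lex-resp-lengths (↭-sym (sameEdges⇒lengths-↭ sF sH same))

  sorted-lengths : (F : Forest n) → DecLengths F (sort (map length F))
  sorted-lengths F = sort-↭ (map length F) , sort-↗ (map length F)

  <lex-by-sorted-lengths : length F ≡ length H → Lex-< _≡_ ℕ._<_ (sort (map length F)) (sort (map length H)) → F <lex H
  <lex-by-sorted-lengths {F = F} {H = H} eq lex = inj₂ (eq , _ , _ , sorted-lengths F , sorted-lengths H , lex)

  SameEdges-sym : SameEdges F H → SameEdges H F
  SameEdges-sym same a b = ⇔.sym (same a b)

  SameEdges-trans : ∀ {K} → SameEdges F H → SameEdges H K → SameEdges F K
  SameEdges-trans same same′ a b = ⇔.trans (same a b) (same′ a b)

  ↭⇒SameEdges : F ↭ H → SameEdges F H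
  ↭⇒SameEdges p _ _ = mk⇔ (↭.Any-resp-↭ p) (↭.Any-resp-↭ (↭-sym p))

  spanning-↭ : {G : Graph n} → IsSpanningLF G F → F ↭ H → IsSpanningLF G H
  spanning-↭ s p = record
    { nonempty = ↭.All-resp-↭ p (IsSpanningLF.nonempty s)
    ; along    = ↭.All-resp-↭ p (IsSpanningLF.along s)
    ; spanning = ↭-trans (↭-sym (concat-↭ p)) (IsSpanningLF.spanning s)
    }

  Adj-sym : (G : Graph n) → Adj G a b → Adj G b a
  Adj-sym {a = a} {b = b} G e = trans (Graph.sym G b a) e

  Adj-irrefl : (G : Graph n) → ¬ Adj G a a
  Adj-irrefl {a = a} G e with () ← trans (sym e) (Graph.irrefl G a)

  spanning-reverse₂ : {G : Graph n} → IsSpanningLF G (R ∷ S ∷ F) → IsSpanningLF G (R ∷ reverse S ∷ F)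
  spanning-reverse₂ {R = R} {S = S} {F = F} {G = G} s
    with neR ∷ neS ∷ ne ← IsSpanningLF.nonempty s | lR ∷ lS ∷ l ← IsSpanningLF.along s = record
    { nonempty = neR ∷ neS ∘ reverse-injective ∷ ne
    ; along    = lR ∷ Consec⇒Linked (reverse S) (Adj-sym G ∘ Linked⇒Consec lS ∘ Consec-reverse⁻) ∷ l
    ; spanning = ↭-trans (↭.++⁺ˡ R (↭.++⁺ʳ (concat F) (↭.↭-reverse S))) (IsSpanningLF.spanning s)
    }

  SameEdges-reverse₂ : SameEdges (R ∷ S ∷ F) (R ∷ reverse S ∷ F)
  SameEdges-reverse₂ _ _ =
    mk⇔ (on-second (Equivalence.to PathEdge-reverse)) (on-second (Equivalence.from PathEdge-reverse))
    where
    on-second : ∀ {S₁ S₂} → (PathEdge S₁ a b → PathEdge S₂ a b) → EdgeF (R ∷ S₁ ∷ F) a b → EdgeF (R ∷ S₂ ∷ F) a b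
    on-second f (here e)         = here e
    on-second f (there (here e)) = there (here (f e))
    on-second f (there (there e)) = there (there e)

  -- Rotations from an isolated vertex

  RotatedEdges : Forest n → Fin n → Fin n → Fin n → Fin n → Fin n → Set
  RotatedEdges F x y z a b = (EdgeF F a b × ¬ SamePair a b y z) ⊎ SamePair a b x z

  RotationResult : Graph n → Forest n → Forest n → Fin n → Set
  RotationResult G F F′ y = LexMinimal G F′ × Isolated F′ y × SameEnds F F′

  RotatedEdges-sameEdges : SameEdges F H → RotatedEdges F x y z a b ⇔ RotatedEdges H x y z a b
  RotatedEdges-sameEdges same = mk⇔ (transport same) (transport (SameEdges-sym same))
    where
    transport : ∀ {F₁ F₂} → SameEdges F₁ F₂ → RotatedEdges F₁ x y z a b → RotatedEdges F₂ x y z a b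
    transport same (inj₁ (e , ¬yz)) = inj₁ (Equivalence.to (same _ _) e , ¬yz)
    transport _    (inj₂ xz)        = inj₂ xz

  pivot-path-≢ : (G : Graph n) → z ∈ R → Adj G x z → [ x ] ≢ R
  pivot-path-≢ G (here refl) xz refl = Adj-irrefl G xz

  orient-pivot-path : {G : Graph n} → IsSpanningLF G F → [ x ] ∈ F → R ∈ F → [ x ] ≢ R → PathEdge R y z →
                      ∃[ Q ] ∃[ rest ] Consec Q y z × IsSpanningLF G ([ x ] ∷ Q ∷ rest)
                                       × SameEdges F ([ x ] ∷ Q ∷ rest)
  orient-pivot-path {R = R} s x∈F R∈F x≢R yz with rest , F↭ ← ∈-∈⇒↭-∷-∷ x∈F R∈F x≢R with yz
  ... | inj₁ c = R , rest , c , spanning-↭ s F↭ , ↭⇒SameEdges F↭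
  ... | inj₂ c = reverse R , rest , Consec-reverse c , spanning-reverse₂ (spanning-↭ s F↭)
                 , SameEdges-trans (↭⇒SameEdges F↭) SameEdges-reverse₂

  LexMinimal⇒¬Adj-singletons : {G : Graph n} → LexMinimal G ([ x ] ∷ [ z ] ∷ F) → ¬ Adj G x z
  LexMinimal⇒¬Adj-singletons {x = x} {z = z} {F = F} (s , minimal) xz
    with _ ∷ _ ∷ ne ← IsSpanningLF.nonempty s | _ ∷ _ ∷ l ← IsSpanningLF.along s =
    minimal ((x ∷ z ∷ []) ∷ F)
      (record { nonempty = (λ ()) ∷ ne ; along = (xz ∷ [-]) ∷ l ; spanning = IsSpanningLF.spanning s })
      (inj₁ (ℕ.n<1+n _))

  split-spanning : {G : Graph n} → ∀ as {bs} → IsSpanningLF G ([ x ] ∷ (as ++ y ∷ z ∷ bs) ∷ F) → Adj G x z →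
                   IsSpanningLF G ((as ++ [ y ]) ∷ (x ∷ z ∷ bs) ∷ F)
  split-spanning {x = x} {y = y} {z = z} {F = F} as {bs} s xz
    with _ ∷ _ ∷ ne ← IsSpanningLF.nonempty s | _ ∷ lQ ∷ l ← IsSpanningLF.along s = record
    { nonempty = [y]≢[] ∘ ++-conicalʳ as [ y ] ∷ (λ ()) ∷ ne
    ; along    = Consec⇒Linked (as ++ [ y ]) (Linked⇒Consec lQ ∘ inQ ∘ Consec-++⁺ʳ (z ∷ bs))
               ∷ (xz ∷ Consec⇒Linked (z ∷ bs) (Linked⇒Consec lQ ∘ inQ ∘ Consec-++⁺ˡ (as ++ [ y ])))
               ∷ l
    ; spanning = ↭-trans concat↭ (IsSpanningLF.spanning s)
    }
    where
    [y]≢[] : [ y ] ≢ []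
    [y]≢[] ()
    Q≡ : (as ++ [ y ]) ++ z ∷ bs ≡ as ++ y ∷ z ∷ bs
    Q≡ = ++-assoc as [ y ] (z ∷ bs)
    inQ : Consec ((as ++ [ y ]) ++ z ∷ bs) a b → Consec (as ++ y ∷ z ∷ bs) a b
    inQ = subst (λ S → Consec S _ _) Q≡
    concat↭ : (as ++ [ y ]) ++ x ∷ z ∷ bs ++ concat F ↭ x ∷ (as ++ y ∷ z ∷ bs) ++ concat F
    concat↭ = ↭-trans (↭.shift x (as ++ [ y ]) (z ∷ bs ++ concat F)) (prep x (↭-reflexive (begin
      (as ++ [ y ]) ++ z ∷ bs ++ concat F  ≡⟨ ++-assoc as [ y ] (z ∷ bs ++ concat F) ⟩
      as ++ y ∷ z ∷ bs ++ concat F        ≡⟨ ++-assoc as (y ∷ z ∷ bs) (concat F) ⟨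
      (as ++ y ∷ z ∷ bs) ++ concat F      ∎)))
      where open ≡-Reasoning

  split-<lex : ∀ as {bs} → (((c ∷ as) ++ [ y ]) ∷ (x ∷ z ∷ bs) ∷ F) <lex ([ x ] ∷ ((c ∷ as) ++ y ∷ z ∷ bs) ∷ F)
  split-<lex {c = c} {y = y} {x = x} {z = z} {F = F} as {bs} = <lex-by-sorted-lengths {F = split} {H = unsplit} refl
    (descending-Lex-< {M = map length F} (sort-↗ _) (sort-↗ _)
      (sort-↭ (map length split)) (↭-trans (sort-↭ (map length unsplit)) (swap 1 _ ↭-refl))
      (subst₂ ℕ._<_ (sym (length-++ (c ∷ as))) (sym (length-++ (c ∷ as)))
        (ℕ.+-monoʳ-< (length (c ∷ as)) (ℕ.s≤s (ℕ.s≤s ℕ.z≤n))))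
      (subst (ℕ._<_ (length (x ∷ z ∷ bs))) (sym (length-++ (c ∷ as)))
        (ℕ.m<n+m (length (x ∷ z ∷ bs)) (ℕ.s≤s ℕ.z≤n))))
    where
    split unsplit : Forest n
    split   = ((c ∷ as) ++ [ y ]) ∷ (x ∷ z ∷ bs) ∷ F
    unsplit = [ x ] ∷ ((c ∷ as) ++ y ∷ z ∷ bs) ∷ F

  rotated-edges-at-end : ∀ {bs} → Unique (concat ([ x ] ∷ (y ∷ z ∷ bs) ∷ F)) →
                     EdgeF ([ y ] ∷ (x ∷ z ∷ bs) ∷ F) a b ⇔ RotatedEdges ([ x ] ∷ (y ∷ z ∷ bs) ∷ F) x y z a b
  rotated-edges-at-end {y = y} {z = z} {F = F} {bs = bs} (_ ∷ u) = mk⇔ to from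
    where
    y∉ : y ∉ z ∷ bs ++ concat F
    y∉ = Unique[x∷xs]⇒x∉xs u
    to : EdgeF ([ y ] ∷ (x ∷ z ∷ bs) ∷ F) a b → RotatedEdges ([ x ] ∷ (y ∷ z ∷ bs) ∷ F) x y z a b
    to (here e) = ⊥-elim (PathEdge-[-] e)
    to (there (here e)) with PathEdge-∷⁻ e
    ... | inj₁ xz = inj₂ xz
    ... | inj₂ e′ = inj₁ (there (here (PathEdge-∷⁺ e′)) , λ yz →
                      y∉ (∈-++⁺ˡ (SamePair-∈ yz (proj₁ (PathEdge-∈ e′)) (proj₂ (PathEdge-∈ e′)))))
    to (there (there e)) with R , R∈F , eR ← find e =
      inj₁ (there (there e) , λ yz →
        y∉ (∈-++⁺ʳ (z ∷ bs)
              (∈-concat⁺′ (SamePair-∈ yz (proj₁ (PathEdge-∈ eR)) (proj₂ (PathEdge-∈ eR))) R∈F)))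
    from : RotatedEdges ([ x ] ∷ (y ∷ z ∷ bs) ∷ F) x y z a b → EdgeF ([ y ] ∷ (x ∷ z ∷ bs) ∷ F) a b
    from (inj₂ xz)                    = there (here (SamePair⇒PathEdge xz))
    from (inj₁ (here e , _))          = ⊥-elim (PathEdge-[-] e)
    from (inj₁ (there (here e) , ¬yz)) with PathEdge-∷⁻ e
    ... | inj₁ yz = ⊥-elim (¬yz yz)
    ... | inj₂ e′ = there (here (PathEdge-∷⁺ e′))
    from (inj₁ (there (there e) , _)) = there (there e)

  IsEndOf-∷⁻ : IsEndOf (c ∷ R) w → w ≡ c ⊎ ∃[ ys ] R ≡ ys ++ [ w ]
  IsEndOf-∷⁻ (_      , inj₁ refl) = inj₁ refl
  IsEndOf-∷⁻ ([]     , inj₂ refl) = inj₁ refl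
  IsEndOf-∷⁻ (_ ∷ ys , inj₂ refl) = inj₂ (ys , refl)

  IsEndOf-∷⁺ : w ≡ c ⊎ ∃[ ys ] R ≡ ys ++ [ w ] → IsEndOf (c ∷ R) w
  IsEndOf-∷⁺ {R = R} (inj₁ refl)        = R , inj₁ refl
  IsEndOf-∷⁺ {c = c} (inj₂ (ys , refl)) = c ∷ ys , inj₂ refl

  IsEnd-swap-heads : IsEnd ([ c ] ∷ (d ∷ R) ∷ F) w → IsEnd ([ d ] ∷ (c ∷ R) ∷ F) w
  IsEnd-swap-heads (here e) with IsEndOf-∷⁻ e
  ... | inj₁ w≡c               = there (here (IsEndOf-∷⁺ (inj₁ w≡c)))
  ... | inj₂ ([]    , ())
  ... | inj₂ (_ ∷ _ , ())
  IsEnd-swap-heads (there (here e)) with IsEndOf-∷⁻ e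
  ... | inj₁ w≡d = here (IsEndOf-∷⁺ (inj₁ w≡d))
  ... | inj₂ end = there (here (IsEndOf-∷⁺ (inj₂ end)))
  IsEnd-swap-heads (there (there e)) = there (there e)

  rotate-oriented : {G : Graph n} → LexMinimal G ([ x ] ∷ R ∷ F) → Adj G x z → Consec R y z →
                    ∀ {F′} → IsSpanningLF G F′ → (∀ a b → EdgeF F′ a b ⇔ RotatedEdges ([ x ] ∷ R ∷ F) x y z a b) →
                    RotationResult G ([ x ] ∷ R ∷ F) F′ y
  rotate-oriented {x = x} {F = F} {z = z} {y = y} {G = G} (s , minimal) xz ([] , bs , refl) {F′} s′ edges′ =
      LexMinimal-sameEdges lm₁ s′ same
    , sameEdges⇒Isolated s₁ s′ same (here refl)
    , λ w → ⇔.trans (mk⇔ IsEnd-swap-heads IsEnd-swap-heads) (sameEdges⇒SameEnds s₁ s′ same w)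
    where
    s₁ : IsSpanningLF G ([ y ] ∷ (x ∷ z ∷ bs) ∷ F)
    s₁ = split-spanning [] s xz
    lm₁ : LexMinimal G ([ y ] ∷ (x ∷ z ∷ bs) ∷ F)
    lm₁ = s₁ , minimal  -- both forests have the path lengths 1 ∷ 2 + length bs ∷ map length F
    same : SameEdges ([ y ] ∷ (x ∷ z ∷ bs) ∷ F) F′
    same a b = ⇔.trans (rotated-edges-at-end (spanning-Unique s)) (⇔.sym (edges′ a b))
  rotate-oriented {x = x} {F = F} {z = z} {y = y} (s , minimal) xz (c ∷ as , bs , refl) _ _ =
    ⊥-elim (minimal _ (split-spanning (c ∷ as) s xz) (split-<lex {c = c} {y = y} {x = x} {z = z} {F = F} as))

  rotate-at-pivot-edge : {G : Graph n} → LexMinimal G F → Isolated F x → R ∈ F → [ x ] ≢ R → PathEdge R y z →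
                         Adj G x z → ∀ {F′} → IsSpanningLF G F′ → (∀ a b → EdgeF F′ a b ⇔ RotatedEdges F x y z a b) →
                         RotationResult G F F′ y
  rotate-at-pivot-edge {F = F} {x = x} {y = y} {z = z} {G = G} lm iso R∈F x≢R yz xz {F′} s′ edges′ =
    finish (orient-pivot-path (proj₁ lm) iso R∈F x≢R yz)
    where
    finish : ∃[ Q ] ∃[ rest ] Consec Q y z × IsSpanningLF G ([ x ] ∷ Q ∷ rest) × SameEdges F ([ x ] ∷ Q ∷ rest) →
             RotationResult G F F′ y
    finish (Q , rest , c , s₀ , same) =
      let lm′ , iso′ , ends = rotate-oriented (LexMinimal-sameEdges lm s₀ same) xz c s′
            (λ a b → ⇔.trans (edges′ a b) (RotatedEdges-sameEdges same))
      in lm′ , iso′ , λ w → ⇔.trans (sameEdges⇒SameEnds (proj₁ lm) s₀ same w) (ends w)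

  oneRot-isolated : {G : Graph n} → LexMinimal G F → Isolated F x → ∀ {F′} → OneRot G F x y z F′ →
                    RotationResult G F F′ y
  oneRot-isolated {F = F} {G = G} lm iso r with OneRot.y-new r
  ... | inj₁ (refl , refl) =
    let rest , F↭ = ∈-∈⇒↭-∷-∷ iso (OneRot.P₂∈F r) (pivot-path-≢ G (OneRot.z∈P₂ r) (OneRot.xz∈G r))
        lm₀ = LexMinimal-sameEdges lm (spanning-↭ (proj₁ lm) F↭) (↭⇒SameEdges F↭)
    in ⊥-elim (LexMinimal⇒¬Adj-singletons lm₀ (OneRot.xz∈G r))
  ... | inj₂ (inj₂ (x∈P₂ , _)) =
    ⊥-elim (pivot-path-≢ G (OneRot.z∈P₂ r) (OneRot.xz∈G r)
             (paths-meet⇒≡ F (spanning-Unique (proj₁ lm)) iso (OneRot.P₂∈F r) (here refl) x∈P₂))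
  ... | inj₂ (inj₁ (_ , yz)) =
    rotate-at-pivot-edge lm iso (OneRot.P₂∈F r) (pivot-path-≢ G (OneRot.z∈P₂ r) (OneRot.xz∈G r)) yz
      (OneRot.xz∈G r) (OneRot.F'-lf r) (OneRot.F'-edges r)

  kRot-isolated : ∀ {G : Graph n} {v k zs F′ u} → LexMinimal G F → Isolated F v → KRot G F v k zs F′ u →
                  RotationResult G F F′ u
  kRot-isolated lm iso done = lm , iso , λ _ → ⇔.refl
  kRot-isolated lm iso (step rotation r _ _) =
    let lm₁ , iso₁ , ends₁ = kRot-isolated lm iso rotation
        lm₂ , iso₂ , ends₂ = oneRot-isolated lm₁ iso₁ r
    in lm₂ , iso₂ , λ w → ⇔.trans (ends₁ w) (ends₂ w)

lemma4p4 : (C : ℚ) → ℕ→ℚ (10 ^ 6) < C →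
           (n : ℕ) → 3 ≤ n → (G : Graph n) → IsExpander C G →
           (F : Forest n) → LexMinimal G F →
           (v : Fin n) → Isolated F v →
           (k : ℕ) (zs : List (Fin n)) (F' : Forest n) (u : Fin n) →
           KRot G F v k zs F' u →
           LexMinimal G F' × Isolated F' u × (∀ w → IsEnd F w ⇔ IsEnd F' w)
lemma4p4 _ _ _ _ _ _ _ lm _ iso _ _ _ _ = kRot-isolated lm iso
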